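{- With the notation below, $T_0(\triangle_{00})=\triangle_0\cap M_0=\{\lambda: \lambda_1<\lambda_2+\lambda_m,\ k_1>k_m\}$, $T_0(\triangle_{01})=\triangle_1\cap M_0=\{\lambda: \lambda_1>\lambda_2+\lambda_m,\ k_1>k_m\}$, $T_1(\triangle_{10})=\triangle_0\cap M_1=\{\lambda: \lambda_1<\lambda_2+\lambda_m,\ k_1<k_m\}$, $T_1(\triangle_{11})=\triangle_1\cap M_1=\{\lambda: \lambda_1>\lambda_2+\lambda_m,\ k_1<k_m\}$, where $\lambda$ ranges over partitions of dimension $\ge2$.
   Context: A partition is written $(\lambda_1,\dots,\lambda_m)\times[k_1,\dots,k_m]$, where $m\ge1$, the parts $\lambda_i$ are integers with $\lambda_1>\dots>\lambda_m>0$ and the multiplicities $k_i$ are positive integers; $m$ is its dimension. Among partitions of dimension $m\ge2$, $\triangle_0$ is the set with $\lambda_1<\lambda_2+\lambda_m$ and $\triangle_1$ the set with $\lambda_1>\lambda_2+\lambda_m$ (for $m=2$, $\lambda_2+\lambda_m$ means $2\lambda_2$); $M_0$ is the set of partitions with $k_1>k_m$ and $M_1$ the set with $k_1<k_m$. $T_0(\lambda)=(\lambda_2,\dots,\lambda_m,\lambda_1-\lambda_2)\times[k_1+k_2,k_3,\dots,k_m,k_1]$ for $\lambda\in\triangle_0$ (for $m=2$: $(\lambda_2,\lambda_1-\lambda_2)\times[k_1+k_2,k_1]$), and $T_1(\lambda)=(\lambda_1-\lambda_m,\lambda_2,\dots,\lambda_m)\times[k_1,\dots,k_{m-1},k_1+k_m]$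 for $\lambda\in\triangle_1$. The cylinder sets are $\triangle_{ij}=\{\lambda\in\triangle_i:T_i(\lambda)\in\triangle_j\}$ for $i,j\in\{0,1\}$. -}

module Defs where

open import Data.Nat using (ℕ; zero; suc; _+_; _∸_; _<_; _>_)
open import Data.Product using (_×_; _,_; proj₁; proj₂; ∃)
open import Data.Unit using (⊤)
open import Data.Vec using (Vec; []; _∷_; _∷ʳ_; head; tail; last; init)
open import Data.Vec.Relation.Unary.All using (All)
open import Relation.Binary.PropositionalEquality using (_≡_)

-- A partition of dimension m is a vector of m pairs (λ_i , k_i).
-- Partitions of dimension ≥ 2 are vectors of length suc (suc n).
Part : ℕ → Set
Part m = Vec (ℕ × ℕ) m

StrictDec : ∀ {m} → Part m → Set
StrictDec [] = ⊤
StrictDec (x ∷ []) = ⊤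
StrictDec (x ∷ y ∷ r) = (proj₁ y < proj₁ x) × StrictDec (y ∷ r)

Positive : ℕ × ℕ → Set
Positive (l , k) = (0 < l) × (0 < k)

IsPartition : ∀ {m} → Part m → Set
IsPartition v = StrictDec v × All Positive v

module _ {n : ℕ} where
  λ₁ λ₂ λₘ k₁ kₘ : Part (suc (suc n)) → ℕ
  λ₁ v = proj₁ (head v)
  λ₂ v = proj₁ (head (tail v))
  λₘ v = proj₁ (last v)
  k₁ v = proj₂ (head v)
  kₘ v = proj₂ (last v)

  -- △₀ : λ₁ < λ₂ + λₘ ;  △₁ : λ₁ > λ₂ + λₘ  (for m = 2, λₘ = λ₂)
  Tri₀ Tri₁ M₀ M₁ : Part (suc (suc n)) → Set
  Tri₀ v = IsPartition v × (λ₁ v < λ₂ v + λₘ v)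
  Tri₁ v = IsPartition v × (λ₁ v > λ₂ v + λₘ v)
  M₀ v = IsPartition v × (k₁ v > kₘ v)
  M₁ v = IsPartition v × (k₁ v < kₘ v)

  T₀ : Part (suc (suc n)) → Part (suc (suc n))
  T₀ ((l1 , a1) ∷ (l2 , a2) ∷ rest) = (l2 , a1 + a2) ∷ (rest ∷ʳ (l1 ∸ l2 , a1))

  T₁ : Part (suc (suc n)) → Part (suc (suc n))
  T₁ ((l1 , a1) ∷ rest) =
    (l1 ∸ proj₁ (last rest) , a1) ∷ (init rest ∷ʳ (proj₁ (last rest) , a1 + proj₂ (last rest)))

  Tri₀₀ Tri₀₁ Tri₁₀ Tri₁₁ : Part (suc (suc n)) → Set
  Tri₀₀ v = Tri₀ v × Tri₀ (T₀ v)
  Tri₀₁ v = Tri₀ v × Tri₁ (T₀ v)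
  Tri₁₀ v = Tri₁ v × Tri₀ (T₁ v)
  Tri₁₁ v = Tri₁ v × Tri₁ (T₁ v)

Image : {A : Set} → (A → A) → (A → Set) → A → Set
Image f S y = ∃ λ x → S x × (f x ≡ y)

_∩_ : {A : Set} → (A → Set) → (A → Set) → A → Set
(S ∩ R) x = S x × R x

module Submission where

-- T₀ maps △₀ onto M₀ and T₁ maps △₁ onto M₁: the multiplicity that T₀ puts first
-- is k₁ + k₂ > k₁ = the one it puts last, and conversely (λ₁,…,λₘ) × [k₁,…,kₘ] with
-- k₁ > kₘ is the T₀-image of (λ₁ + λₘ, λ₁, λ₂, …, λₘ₋₁) × [kₘ, k₁ − kₘ, k₂, …, kₘ₋₁],
-- which lies in △₀ (symmetrically for T₁, with preimage (λ₁ + λₘ, λ₂, …, λₘ) ×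
-- [k₁, …, kₘ₋₁, kₘ − k₁]).
-- The theorem then follows from the identity f(S ∩ f⁻¹ C) = C ∩ f(S).

open import Defs
open import Data.Nat using (ℕ; suc; _+_; _∸_; _<_)
open import Data.Nat.Properties
open import Data.Product using (_×_; _,_; proj₁; proj₂)
open import Data.Unit using (tt)
open import Data.Vec using (Vec; []; _∷_; _∷ʳ_; head; last; initLast)
open import Data.Vec.Properties using (last-∷ʳ; init-∷ʳ)
open import Data.Vec.Relation.Unary.All using (All; []; _∷_)
open import Relation.Binary.PropositionalEquality using (_≡_; refl; sym; trans; subst; cong; cong₂)
open import Function.Bundles using (_⇔_; mk⇔)

image-∩-preimage : {A : Set} (f : A → A) (S P C : A → Set) →
  (∀ x → S x → P (f x)) → (∀ y → P y → Image f S y) →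
  ∀ y → Image f (λ x → S x × C (f x)) y ⇔ (C ∩ P) y
image-∩-preimage f S P C into onto y = mk⇔
  (λ { (x , (s , c) , refl) → c , into x s })
  (λ { (c , p) → let x , s , fx≡y = onto y p in x , (s , subst C (sym fx≡y) c) , fx≡y })

private
  variable
    m : ℕ

All-∷ʳ⁺ : {A : Set} {P : A → Set} (xs : Vec A m) {z : A} → All P xs → P z → All P (xs ∷ʳ z)
All-∷ʳ⁺ []       []         pz = pz ∷ []
All-∷ʳ⁺ (x ∷ xs) (px ∷ pxs) pz = px ∷ All-∷ʳ⁺ xs pxs pz

All-∷ʳ⁻ : {A : Set} {P : A → Set} (xs : Vec A m) {z : A} → All P (xs ∷ʳ z) → All P xs × P z
All-∷ʳ⁻ []       (pz ∷ [])  = [] , pz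
All-∷ʳ⁻ (x ∷ xs) (px ∷ pxs) = let pxs′ , pz = All-∷ʳ⁻ xs pxs in px ∷ pxs′ , pz

StrictDec-∷⁺ : ∀ x (ys : Part (suc m)) → proj₁ (head ys) < proj₁ x → StrictDec ys → StrictDec (x ∷ ys)
StrictDec-∷⁺ x (y ∷ ys) y<x sd = y<x , sd

StrictDec-∷⁻ : ∀ x (ys : Part (suc m)) → StrictDec (x ∷ ys) → proj₁ (head ys) < proj₁ x × StrictDec ys
StrictDec-∷⁻ x (y ∷ ys) sd = sd

StrictDec-∷-mult : ∀ l a a′ (xs : Part m) → StrictDec ((l , a) ∷ xs) → StrictDec ((l , a′) ∷ xs)
StrictDec-∷-mult l a a′ []       sd = tt
StrictDec-∷-mult l a a′ (y ∷ ys) sd = sd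

proj₁-last-∷-mult : ∀ l a a′ (xs : Part m) → proj₁ (last ((l , a) ∷ xs)) ≡ proj₁ (last ((l , a′) ∷ xs))
proj₁-last-∷-mult l a a′ []       = refl
proj₁-last-∷-mult l a a′ (y ∷ ys) = refl

StrictDec-∷ʳ⁺ : ∀ (xs : Part (suc m)) z → proj₁ z < proj₁ (last xs) → StrictDec xs → StrictDec (xs ∷ʳ z)
StrictDec-∷ʳ⁺ (x ∷ [])     z z<last _          = z<last , tt
StrictDec-∷ʳ⁺ (x ∷ y ∷ ys) z z<last (y<x , sd) = y<x , StrictDec-∷ʳ⁺ (y ∷ ys) z z<last sd

StrictDec-∷ʳ⁻ : ∀ (xs : Part (suc m)) z → StrictDec (xs ∷ʳ z) → proj₁ z < proj₁ (last xs) × StrictDec xs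
StrictDec-∷ʳ⁻ (x ∷ [])     z (z<x , _)  = z<x , tt
StrictDec-∷ʳ⁻ (x ∷ y ∷ ys) z (y<x , sd) = let z<last , sd′ = StrictDec-∷ʳ⁻ (y ∷ ys) z sd in z<last , y<x , sd′

StrictDec-∷ʳ-mult : ∀ (xs : Part (suc m)) q c c′ → StrictDec (xs ∷ʳ (q , c)) → StrictDec (xs ∷ʳ (q , c′))
StrictDec-∷ʳ-mult xs q c c′ sd =
  let q<last , sd′ = StrictDec-∷ʳ⁻ xs (q , c) sd in StrictDec-∷ʳ⁺ xs (q , c′) q<last sd′

module _ {n : ℕ} where

  T₁-∷ʳ : ∀ l a (r : Part n) q c → T₁ ((l , a) ∷ (r ∷ʳ (q , c))) ≡ (l ∸ q , a) ∷ (r ∷ʳ (q , a + c))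
  T₁-∷ʳ l a r q c rewrite last-∷ʳ (q , c) r | init-∷ʳ (q , c) r = refl

  T₀-into-M₀ : (v : Part (suc (suc n))) → Tri₀ v → M₀ (T₀ v)
  T₀-into-M₀ ((l₁ , a₁) ∷ (l₂ , a₂) ∷ rest) (((l₂<l₁ , sd) , (_ , a₁>0) ∷ (l₂>0 , a₂>0) ∷ ps) , tri) =
    (StrictDec-∷ʳ⁺ xs z z<last (StrictDec-∷-mult l₂ a₂ (a₁ + a₂) rest sd) , All-∷ʳ⁺ xs pxs pz) , kₘ<k₁
    where
    xs : Part (suc n)
    xs = (l₂ , a₁ + a₂) ∷ rest
    z : ℕ × ℕ
    z = (l₁ ∸ l₂ , a₁)
    z<last : l₁ ∸ l₂ < proj₁ (last xs)
    z<last = subst (l₁ ∸ l₂ <_) (trans (m+n∸m≡n l₂ _) (proj₁-last-∷-mult l₂ a₂ (a₁ + a₂) rest))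
                   (∸-monoˡ-< tri (<⇒≤ l₂<l₁))
    pxs : All Positive xs
    pxs = (l₂>0 , <-≤-trans a₂>0 (m≤n+m a₂ a₁)) ∷ ps
    pz : Positive z
    pz = m<n⇒0<n∸m l₂<l₁ , a₁>0
    kₘ<k₁ : proj₂ (last (xs ∷ʳ z)) < a₁ + a₂
    kₘ<k₁ = subst (_< a₁ + a₂) (sym (cong proj₂ (last-∷ʳ z xs))) (m<m+n a₁ a₂>0)

  T₀-onto-M₀ : (μ : Part (suc (suc n))) → M₀ μ → Image T₀ Tri₀ μ
  T₀-onto-M₀ ((p , b) ∷ s) ((sd , (p>0 , _) ∷ ps) , c<b) with initLast s
  ... | r , (q , c) , refl = v , ((sdv , posv) , tri) , T₀v≡μ
    where
    v : Part (suc (suc n))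
    v = (p + q , c) ∷ (p , b ∸ c) ∷ r
    q<last : q < proj₁ (last ((p , b) ∷ r))
    q<last = proj₁ (StrictDec-∷ʳ⁻ ((p , b) ∷ r) (q , c) sd)
    psr : All Positive r
    psr = proj₁ (All-∷ʳ⁻ r ps)
    q>0 : 0 < q
    q>0 = proj₁ (proj₂ (All-∷ʳ⁻ r ps))
    sdv : StrictDec v
    sdv = m<m+n p q>0 , StrictDec-∷-mult p b (b ∸ c) r (proj₂ (StrictDec-∷ʳ⁻ ((p , b) ∷ r) (q , c) sd))
    posv : All Positive v
    posv = (<-≤-trans p>0 (m≤m+n p q) , proj₂ (proj₂ (All-∷ʳ⁻ r ps))) ∷ (p>0 , m<n⇒0<n∸m c<b) ∷ psr
    tri : p + q < p + proj₁ (last ((p , b ∸ c) ∷ r))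
    tri = +-monoʳ-< p (subst (q <_) (proj₁-last-∷-mult p b (b ∸ c) r) q<last)
    T₀v≡μ : T₀ v ≡ (p , b) ∷ (r ∷ʳ (q , c))
    T₀v≡μ = cong₂ (λ k l → (p , k) ∷ (r ∷ʳ (l , c))) (m+[n∸m]≡n (<⇒≤ c<b)) (m+n∸m≡n p q)

  -- last and init are defined through initLast, so abstracting initLast s makes
  -- T₁ v, λₘ v and kₘ v compute on the split form.
  T₁-into-M₁ : (v : Part (suc (suc n))) → Tri₁ v → M₁ (T₁ v)
  T₁-into-M₁ ((l , a) ∷ s) ((sd , (_ , a>0) ∷ ps) , tri) with initLast s
  ... | r , (q , c) , refl = (sdT , posT) , k₁<kₘ
    where
    l₂ : ℕ
    l₂ = proj₁ (head (r ∷ʳ (q , c)))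
    l₂<l∸q : l₂ < l ∸ q
    l₂<l∸q = m+n≤o⇒m≤o∸n (suc l₂) tri
    sdT : StrictDec ((l ∸ q , a) ∷ (r ∷ʳ (q , a + c)))
    sdT = StrictDec-∷ʳ-mult ((l ∸ q , a) ∷ r) q c (a + c)
            (StrictDec-∷⁺ (l ∸ q , a) (r ∷ʳ (q , c)) l₂<l∸q (proj₂ (StrictDec-∷⁻ (l , a) (r ∷ʳ (q , c)) sd)))
    posT : All Positive ((l ∸ q , a) ∷ (r ∷ʳ (q , a + c)))
    posT = let psr , q>0 , c>0 = All-∷ʳ⁻ r ps in
           (m<n⇒0<n∸m (≤-<-trans (m≤n+m q l₂) tri) , a>0) ∷ All-∷ʳ⁺ r psr (q>0 , <-≤-trans c>0 (m≤n+m c a))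
    k₁<kₘ : a < proj₂ (last ((l ∸ q , a) ∷ (r ∷ʳ (q , a + c))))
    k₁<kₘ = subst (a <_) (sym (cong proj₂ (last-∷ʳ (q , a + c) ((l ∸ q , a) ∷ r))))
                  (m<m+n a (proj₂ (proj₂ (All-∷ʳ⁻ r ps))))

  T₁-onto-M₁ : (μ : Part (suc (suc n))) → M₁ μ → Image T₁ Tri₁ μ
  T₁-onto-M₁ ((p , b) ∷ s) ((sd , (p>0 , b>0) ∷ ps) , b<c) with initLast s
  ... | r , (q , c) , refl = v , ((sdv , posv) , tri) , T₁v≡μ
    where
    v : Part (suc (suc n))
    v = (p + q , b) ∷ (r ∷ʳ (q , c ∸ b))
    l₂<p×sd : proj₁ (head (r ∷ʳ (q , c ∸ b))) < p × StrictDec (r ∷ʳ (q , c ∸ b))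
    l₂<p×sd = StrictDec-∷⁻ (p , b) (r ∷ʳ (q , c ∸ b)) (StrictDec-∷ʳ-mult ((p , b) ∷ r) q c (c ∸ b) sd)
    sdv : StrictDec v
    sdv = StrictDec-∷⁺ (p + q , b) (r ∷ʳ (q , c ∸ b))
            (<-≤-trans (proj₁ l₂<p×sd) (m≤m+n p q)) (proj₂ l₂<p×sd)
    posv : All Positive v
    posv = let psr , q>0 , _ = All-∷ʳ⁻ r ps in
           (<-≤-trans p>0 (m≤m+n p q) , b>0) ∷ All-∷ʳ⁺ r psr (q>0 , m<n⇒0<n∸m b<c)
    tri : proj₁ (head (r ∷ʳ (q , c ∸ b))) + proj₁ (last v) < p + q
    tri = subst (λ x → proj₁ (head (r ∷ʳ (q , c ∸ b))) + x < p + q)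
                (sym (cong proj₁ (last-∷ʳ (q , c ∸ b) ((p + q , b) ∷ r))))
                (+-monoˡ-< q (proj₁ l₂<p×sd))
    T₁v≡μ : T₁ v ≡ (p , b) ∷ (r ∷ʳ (q , c))
    T₁v≡μ = trans (T₁-∷ʳ (p + q) b r q (c ∸ b))
                  (cong₂ (λ l k → (l , b) ∷ (r ∷ʳ (q , k))) (m+n∸n≡m p q) (m+[n∸m]≡n (<⇒≤ b<c)))

mainTheorem6 : (n : ℕ) (μ : Part (suc (suc n))) →
    (Image T₀ Tri₀₀ μ ⇔ (Tri₀ ∩ M₀) μ)
    × (Image T₀ Tri₀₁ μ ⇔ (Tri₁ ∩ M₀) μ)
    × (Image T₁ Tri₁₀ μ ⇔ (Tri₀ ∩ M₁) μ)
    × (Image T₁ Tri₁₁ μ ⇔ (Tri₁ ∩ M₁) μ)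
mainTheorem6 n μ =
    image-∩-preimage T₀ Tri₀ M₀ Tri₀ T₀-into-M₀ T₀-onto-M₀ μ
  , image-∩-preimage T₀ Tri₀ M₀ Tri₁ T₀-into-M₀ T₀-onto-M₀ μ
  , image-∩-preimage T₁ Tri₁ M₁ Tri₀ T₁-into-M₁ T₁-onto-M₁ μ
  , image-∩-preimage T₁ Tri₁ M₁ Tri₁ T₁-into-M₁ T₁-onto-M₁ μ
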